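{- Let $G$ be a graph and let $C$ be a connected component of $\mathcal{I}^1_{\mathrm{AR}}(G)$. Then $G$ is a complete join $G_1\bowtie G_2$ with $C\cong\mathcal{I}^1_{\mathrm{AR}}(G_1)$ and $\mathcal{I}^1_{\mathrm{AR}}(G)-C\cong\mathcal{I}^1_{\mathrm{AR}}(G_2)$.
   Context: $\mathcal{I}^1_{\mathrm{AR}}(G)$ is the graph whose vertices are the non-empty independent sets of $G$, two being adjacent iff one is obtained from the other by adding or removing a single vertex. The complete join $G_1\bowtie G_2$ is the disjoint union of $G_1$ and $G_2$ together with all edges between $V(G_1)$ and $V(G_2)$ ($G_2$ may be the empty graph). $\mathcal{I}^1_{\mathrm{AR}}(G)-C$ denotes $\mathcal{I}^1_{\mathrm{AR}}(G)$ with the vertices of $C$ deleted. -}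

module Defs where

open import Data.Nat using (ℕ; _+_)
open import Data.Bool using (Bool; true; false)
open import Data.Fin using (Fin; splitAt)
open import Data.Fin.Subset using (Subset; _∈_; _∉_; _∪_; ⁅_⁆; Nonempty)
open import Data.Sum using (_⊎_; inj₁; inj₂)
open import Data.Product using (Σ; _×_; ∃)
open import Data.Irrelevant using (Irrelevant)
open import Relation.Nullary using (¬_)
open import Relation.Binary.PropositionalEquality using (_≡_; refl)
open import Relation.Binary.Construct.Closure.ReflexiveTransitive using (Star)
open import Function.Bundles using (_⇔_)

record SimpleGraph : Set₁ where
  field
    n     : ℕ
    adj   : Fin n → Fin n → Bool
    sym   : ∀ u v → adj u v ≡ adj v u
    irref : ∀ v → adj v v ≡ false
open SimpleGraph public

record Graph : Set₁ where
  field
    V : Set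
    E : V → V → Set
open Graph public

record _≅_ (A B : Graph) : Set where
  field
    to       : V A → V B
    from     : V B → V A
    from-to  : ∀ x → from (to x) ≡ x
    to-from  : ∀ y → to (from y) ≡ y
    edges    : ∀ x y → E A x y ⇔ E B (to x) (to y)

toGraph : SimpleGraph → Graph
toGraph G = record { V = Fin (n G) ; E = λ u v → adj G u v ≡ true }

-- Induced subgraph on the vertices satisfying P (the proof of P is
-- irrelevant, so vertices are determined by the underlying vertex).
induced : (H : Graph) → (V H → Set) → Graph
induced H P = record
  { V = Σ (V H) (λ x → Irrelevant (P x))
  ; E = λ x y → E H (Σ.proj₁ x) (Σ.proj₁ y) }

Independent : (G : SimpleGraph) → Subset (n G) → Set
Independent G S = ∀ u v → u ∈ S → v ∈ S → adj G u v ≡ false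

AddsOne : ∀ {m} → Subset m → Subset m → Set
AddsOne {m} S T = ∃ λ (v : Fin m) → v ∉ S × T ≡ S ∪ ⁅ v ⁆

IAR : SimpleGraph → Graph
IAR G = record
  { V = Σ (Subset (n G)) (λ S → Irrelevant (Nonempty S × Independent G S))
  ; E = λ S T → AddsOne (Σ.proj₁ S) (Σ.proj₁ T) ⊎ AddsOne (Σ.proj₁ T) (Σ.proj₁ S) }

Reachable : (H : Graph) → V H → V H → Set
Reachable H = Star (E H)

component : (H : Graph) → V H → Graph
component H x = induced H (λ y → Reachable H x y)

minusComponent : (H : Graph) → V H → Graph
minusComponent H x = induced H (λ y → ¬ Reachable H x y)

-- Complete join G1 ⋈ G2 on Fin (n G1 + n G2): the first n G1 vertices
-- form G1, the rest form G2, and all cross pairs are adjacent.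
joinAdj : (G₁ G₂ : SimpleGraph) → Fin (n G₁ + n G₂) → Fin (n G₁ + n G₂) → Bool
joinAdj G₁ G₂ x y with splitAt (n G₁) x | splitAt (n G₁) y
... | inj₁ a | inj₁ b = adj G₁ a b
... | inj₂ a | inj₂ b = adj G₂ a b
... | inj₁ _ | inj₂ _ = true
... | inj₂ _ | inj₁ _ = true

joinAdj-sym : ∀ G₁ G₂ x y → joinAdj G₁ G₂ x y ≡ joinAdj G₁ G₂ y x
joinAdj-sym G₁ G₂ x y with splitAt (n G₁) x | splitAt (n G₁) y
... | inj₁ a | inj₁ b = sym G₁ a b
... | inj₂ a | inj₂ b = sym G₂ a b
... | inj₁ _ | inj₂ _ = refl
... | inj₂ _ | inj₁ _ = refl

joinAdj-irref : ∀ G₁ G₂ x → joinAdj G₁ G₂ x x ≡ false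
joinAdj-irref G₁ G₂ x with splitAt (n G₁) x
... | inj₁ a = irref G₁ a
... | inj₂ a = irref G₂ a

_⋈_ : SimpleGraph → SimpleGraph → SimpleGraph
G₁ ⋈ G₂ = record
  { n = n G₁ + n G₂
  ; adj = joinAdj G₁ G₂
  ; sym = joinAdj-sym G₁ G₂
  ; irref = joinAdj-irref G₁ G₂ }

{-# OPTIONS --safe #-}

-- Independent sets of G are cliques of the complement graph Ḡ, so adding or removing a
-- vertex never moves an independent set out of the component of Ḡ containing it, while
-- S, {u}, {u, w}, {w}, T is a path in I¹_AR(G) whenever u ∈ S and w ∈ T are adjacent in Ḡ.
-- Hence, if K is the component of Ḡ meeting x, the component of x consists of the
-- independent sets inside K and the remaining ones are those inside V ∖ K.  No edge of Ḡ
-- leaves K, so G = G[K] ⋈ G[V ∖ K], and restricting to K (resp. V ∖ K) identifies the two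
-- parts with I¹_AR(G[K]) and I¹_AR(G[V ∖ K]).

module Submission where

open import Defs
open import Data.Nat using (ℕ; zero; suc; _+_; _≤_; z≤n)
open import Data.Nat.Properties using (≤-<-trans; <⇒≱)
open import Data.Bool using (Bool; true; false; _≟_)
open import Data.Bool.Properties using (∨-identityʳ)
open import Data.Fin using (Fin; zero; suc; splitAt; join)
open import Data.Fin.Properties using (any?; +↔⊎; splitAt-join) renaming (_≟_ to _≟ᶠ_)
open import Data.Fin.Subset using (Subset; _∈_; _∉_; _⊆_; _⊂_; _∪_; ⁅_⁆; ∁; ∣_∣; Nonempty; inside; outside)
open import Data.Fin.Subset.Properties
  using (_∈?_; _⊆?_; nonempty?; ⊆-refl; ⊆-trans; ⊆-antisym; p⊆p∪q; q⊆p∪q; x∈p∪q⁻; x∈p∪q⁺;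
         x∈⁅x⁆; x∈⁅y⁆⇒x≡y; ∪-identityʳ; drop-there; drop-∷-⊆; p⊂q⇒∣p∣<∣q∣; ∣p∣≤n;
         x∉p⇒x∈∁p; x∈p⇒x∉∁p; x∈∁p⇒x∉p)
open import Data.Vec using ([]; _∷_; tabulate; here; there)
open import Data.Vec.Properties using ([]=⇒lookup; lookup⇒[]=; lookup∘tabulate)
open import Data.Sum using (_⊎_; inj₁; inj₂; swap; map₁) renaming (map to ⊎-map)
open import Data.Sum.Properties using (inj₁-injective; swap-↔)
open import Data.Product using (Σ; _×_; _,_; proj₁; proj₂; ∃)
open import Data.Irrelevant using (Irrelevant; [_])
open import Relation.Nullary using (¬_; Dec; yes; no; does; ¬?; contradiction)
open import Relation.Nullary.Decidable using (recompute; decidable-stable; dec-true; _×-dec_)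
open import Relation.Unary using (Pred)
open import Relation.Binary using (Rel; Decidable)
open import Relation.Binary.PropositionalEquality
  using (_≡_; _≢_; refl; trans; cong; cong₂; subst; subst₂; module ≡-Reasoning) renaming (sym to ≡-sym)
open import Relation.Binary.Construct.Closure.ReflexiveTransitive using (Star; ε; _◅_; _◅◅_; gmap; fold; reverse)
open import Function using (_∘_; id)
open import Function.Bundles using (_⇔_; mk⇔; Equivalence; _↔_; Inverse; mk↔ₛ′)
open import Function.Construct.Composition using (_⇔-∘_)
open import Function.Properties.Inverse using (↔-trans; ↔-sym)

module ⇔ = Equivalence
open Inverse using (to; from; strictlyInverseˡ; strictlyInverseʳ)

≅-trans : ∀ {A B C} → A ≅ B → B ≅ C → A ≅ C
≅-trans f g = record
  { to      = _≅_.to g ∘ _≅_.to f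
  ; from    = _≅_.from f ∘ _≅_.from g
  ; from-to = λ x → trans (cong (_≅_.from f) (_≅_.from-to g (_≅_.to f x))) (_≅_.from-to f x)
  ; to-from = λ y → trans (cong (_≅_.to g) (_≅_.to-from f (_≅_.from g y))) (_≅_.to-from g y)
  ; edges   = λ x y → _≅_.edges g (_≅_.to f x) (_≅_.to f y) ⇔-∘ _≅_.edges f x y
  }

mk≅ : ∀ {A B} (to : V A → V B) (from : V B → V A) →
      (∀ x → from (to x) ≡ x) → (∀ y → to (from y) ≡ y) →
      (∀ {x y} → E A x y → E B (to x) (to y)) → (∀ {x y} → E B x y → E A (from x) (from y)) →
      A ≅ B
mk≅ {A} to from from-to to-from to-E from-E = record
  { to = to ; from = from ; from-to = from-to ; to-from = to-from
  ; edges = λ x y → mk⇔ to-E (λ e → subst₂ (E A) (from-to x) (from-to y) (from-E e))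
  }

Σ-irrelevant-≡ : ∀ {A : Set} {P : A → Set} {a b : Σ A (λ x → Irrelevant (P x))} →
                 proj₁ a ≡ proj₁ b → a ≡ b
Σ-irrelevant-≡ refl = refl

induced-cong : ∀ {H : Graph} {P Q : V H → Set} → (∀ x → P x ⇔ Q x) → induced H P ≅ induced H Q
induced-cong P⇔Q = mk≅
  (λ { (x , [ p ]) → x , [ ⇔.to (P⇔Q x) p ] })
  (λ { (x , [ q ]) → x , [ ⇔.from (P⇔Q x) q ] })
  (λ _ → refl) (λ _ → refl) id id

∈-tabulate-does : ∀ {N p} {P : Pred (Fin N) p} (P? : ∀ w → Dec (P w)) {w} →
                  w ∈ tabulate (does ∘ P?) ⇔ P w
∈-tabulate-does P? {w} = mk⇔
  (λ w∈ → witness (P? w) (trans (≡-sym (lookup∘tabulate (does ∘ P?) w)) ([]=⇒lookup w∈)))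
  (λ Pw → lookup⇒[]= w _ (trans (lookup∘tabulate (does ∘ P?) w) (dec-true (P? w) Pw)))
  where
  witness : ∀ {A : Set _} (a? : Dec A) → does a? ≡ true → A
  witness (yes a) _ = a

⁅⁆⊆ : ∀ {N} {u : Fin N} {S} → u ∈ S → ⁅ u ⁆ ⊆ S
⁅⁆⊆ {u = u} {S} u∈S w∈ = subst (_∈ S) (≡-sym (x∈⁅y⁆⇒x≡y u w∈)) u∈S

⊆⇒≡⊎⊂ : ∀ {N} {S T : Subset N} → S ⊆ T → S ≡ T ⊎ S ⊂ T
⊆⇒≡⊎⊂ {S = S} {T} S⊆T with any? (λ w → w ∈? T ×-dec ¬? (w ∈? S))
... | yes (w , w∈T , w∉S) = inj₂ (S⊆T , w , w∈T , w∉S)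
... | no ∄w = inj₁ (⊆-antisym S⊆T T⊆S)
  where
  T⊆S : T ⊆ S
  T⊆S {w} w∈T = decidable-stable (w ∈? S) (λ w∉S → ∄w (w , w∈T , w∉S))

AddsOne⇒⊆ : ∀ {N} {S T : Subset N} → AddsOne S T → S ⊆ T
AddsOne⇒⊆ (v , _ , T≡) w∈S = subst (_ ∈_) (≡-sym T≡) (p⊆p∪q ⁅ v ⁆ w∈S)

Star-AddsOne⇒⊆ : ∀ {N} {S T : Subset N} → Star AddsOne S T → S ⊆ T
Star-AddsOne⇒⊆ = fold _⊆_ (λ S→T T⊆U → ⊆-trans (AddsOne⇒⊆ S→T) T⊆U) ⊆-refl

⊆⇒Star-AddsOne : ∀ {N} {S T : Subset N} → S ⊆ T → Star AddsOne S T
⊆⇒Star-AddsOne {S = []}    {[]}    _   = ε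
⊆⇒Star-AddsOne {S = b ∷ S} {c ∷ T} S⊆T =
  gmap (b ∷_) AddsOne-∷ (⊆⇒Star-AddsOne (drop-∷-⊆ S⊆T)) ◅◅ fix-head b c S⊆T
  where
  AddsOne-∷ : ∀ {U U′} → AddsOne U U′ → AddsOne (b ∷ U) (b ∷ U′)
  AddsOne-∷ (v , v∉ , U′≡) = suc v , v∉ ∘ drop-there , cong₂ _∷_ (≡-sym (∨-identityʳ b)) U′≡
  fix-head : ∀ b c → b ∷ S ⊆ c ∷ T → Star AddsOne (b ∷ T) (c ∷ T)
  fix-head true  true  _ = ε
  fix-head false false _ = ε
  fix-head false true  _ = (zero , (λ ()) , cong (inside ∷_) (≡-sym (∪-identityʳ T))) ◅ ε
  fix-head true  false S⊆T with S⊆T here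
  ... | ()

module _ {k N} (g : Fin k → Fin N) where

  imageOf? : ∀ T w → Dec (∃ λ i → i ∈ T × g i ≡ w)
  imageOf? T w = any? (λ i → i ∈? T ×-dec g i ≟ᶠ w)

  image : Subset k → Subset N
  image T = tabulate (does ∘ imageOf? T)

  preimage : Subset N → Subset k
  preimage S = tabulate (does ∘ λ i → g i ∈? S)

  WithinRange : Subset N → Set
  WithinRange S = ∀ {w} → w ∈ S → ∃ λ i → g i ≡ w

  ∈-image : ∀ {T w} → w ∈ image T ⇔ ∃ λ i → i ∈ T × g i ≡ w
  ∈-image {T} = ∈-tabulate-does (imageOf? T)

  ∈-preimage : ∀ {S i} → i ∈ preimage S ⇔ g i ∈ S
  ∈-preimage {S} = ∈-tabulate-does (λ i → g i ∈? S)

  g∈image : ∀ {T i} → i ∈ T → g i ∈ image T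
  g∈image i∈T = ⇔.from ∈-image (_ , i∈T , refl)

  ∈⁅⁆⇒g∈⁅g⁆ : ∀ {i j} → j ∈ ⁅ i ⁆ → g j ∈ ⁅ g i ⁆
  ∈⁅⁆⇒g∈⁅g⁆ {i} j∈ rewrite x∈⁅y⁆⇒x≡y i j∈ = x∈⁅x⁆ (g i)

  image-∪-⁅⁆ : ∀ T i → image (T ∪ ⁅ i ⁆) ≡ image T ∪ ⁅ g i ⁆
  image-∪-⁅⁆ T i = ⊆-antisym ⊆∪ ∪⊆
    where
    ⊆∪ : image (T ∪ ⁅ i ⁆) ⊆ image T ∪ ⁅ g i ⁆
    ⊆∪ w∈ with ⇔.to ∈-image w∈
    ... | j , j∈ , refl = x∈p∪q⁺ (⊎-map g∈image ∈⁅⁆⇒g∈⁅g⁆ (x∈p∪q⁻ T ⁅ i ⁆ j∈))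
    ∪⊆ : image T ∪ ⁅ g i ⁆ ⊆ image (T ∪ ⁅ i ⁆)
    ∪⊆ w∈ with x∈p∪q⁻ (image T) ⁅ g i ⁆ w∈
    ... | inj₂ w∈gi rewrite x∈⁅y⁆⇒x≡y (g i) w∈gi = g∈image (q⊆p∪q T ⁅ i ⁆ (x∈⁅x⁆ i))
    ... | inj₁ w∈T with ⇔.to ∈-image w∈T
    ...   | j , j∈ , refl = g∈image (p⊆p∪q ⁅ i ⁆ j∈)

  image-nonempty : ∀ {T} → Nonempty T → Nonempty (image T)
  image-nonempty (i , i∈) = g i , g∈image i∈

  preimage-nonempty : ∀ {S} → WithinRange S → Nonempty S → Nonempty (preimage S)
  preimage-nonempty S⊆range (w , w∈) with S⊆range w∈
  ... | i , refl = i , ⇔.from ∈-preimage w∈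

  preimage-∪ : ∀ S T → preimage (S ∪ T) ≡ preimage S ∪ preimage T
  preimage-∪ S T = ⊆-antisym
    (λ i∈ → x∈p∪q⁺ (⊎-map (⇔.from ∈-preimage) (⇔.from ∈-preimage)
                             (x∈p∪q⁻ S T (⇔.to ∈-preimage i∈))))
    (λ i∈ → ⇔.from ∈-preimage (x∈p∪q⁺ (⊎-map (⇔.to ∈-preimage) (⇔.to ∈-preimage)
                                             (x∈p∪q⁻ _ _ i∈))))

  image-preimage : ∀ {S} → WithinRange S → image (preimage S) ≡ S
  image-preimage {S} S⊆range = ⊆-antisym ⊆S S⊆
    where
    ⊆S : image (preimage S) ⊆ S
    ⊆S w∈ with ⇔.to ∈-image w∈
    ... | i , i∈ , refl = ⇔.to ∈-preimage i∈
    S⊆ : S ⊆ image (preimage S)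
    S⊆ w∈ with S⊆range w∈
    ... | i , refl = g∈image (⇔.from ∈-preimage w∈)

  module _ (g-injective : ∀ {i j} → g i ≡ g j → i ≡ j) where

    preimage-⁅⁆ : ∀ i → preimage ⁅ g i ⁆ ≡ ⁅ i ⁆
    preimage-⁅⁆ i = ⊆-antisym
      (λ j∈ → subst (_∈ ⁅ i ⁆) (≡-sym (g-injective (x∈⁅y⁆⇒x≡y (g i) (⇔.to ∈-preimage j∈))))
                    (x∈⁅x⁆ i))
      (⇔.from ∈-preimage ∘ ∈⁅⁆⇒g∈⁅g⁆)

    preimage-image : ∀ T → preimage (image T) ≡ T
    preimage-image T = ⊆-antisym
      (λ i∈ → let j , j∈ , gj≡gi = ⇔.to ∈-image (⇔.to ∈-preimage i∈)
              in subst (_∈ T) (g-injective gj≡gi) j∈)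
      (⇔.from ∈-preimage ∘ g∈image)

    g∈image⇒∈ : ∀ {T i} → g i ∈ image T → i ∈ T
    g∈image⇒∈ {T} = subst (_ ∈_) (preimage-image T) ∘ ⇔.from ∈-preimage

    AddsOne-image : ∀ {T U} → AddsOne T U → AddsOne (image T) (image U)
    AddsOne-image {T} (i , i∉T , U≡) =
      g i , i∉T ∘ g∈image⇒∈ , trans (cong image U≡) (image-∪-⁅⁆ T i)

    AddsOne-preimage : ∀ {S T} → WithinRange T → AddsOne S T → AddsOne (preimage S) (preimage T)
    AddsOne-preimage {S} {T} T⊆range (v , v∉S , T≡)
      with T⊆range (subst (v ∈_) (≡-sym T≡) (q⊆p∪q S ⁅ v ⁆ (x∈⁅x⁆ v)))
    ... | i , refl = i , v∉S ∘ ⇔.to ∈-preimage , (begin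
      preimage T                        ≡⟨ cong preimage T≡ ⟩
      preimage (S ∪ ⁅ g i ⁆)            ≡⟨ preimage-∪ S ⁅ g i ⁆ ⟩
      preimage S ∪ preimage ⁅ g i ⁆     ≡⟨ cong (preimage S ∪_) (preimage-⁅⁆ i) ⟩
      preimage S ∪ ⁅ i ⁆                ∎)
      where open ≡-Reasoning

-- Decidable reachability

module _ {N} (f : Subset N → Subset N) (inflationary : ∀ S → S ⊆ f S) where
  open import Function.Endo.Propositional (Subset N) using (_^_)

  ⊆-^ : ∀ i {S} → S ⊆ (f ^ i) S
  ⊆-^ zero    w∈ = w∈
  ⊆-^ (suc i) w∈ = inflationary _ (⊆-^ i w∈)

  ^-grows-or-fixed : ∀ i S → i ≤ ∣ (f ^ i) S ∣ ⊎ f ((f ^ i) S) ≡ (f ^ i) S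
  ^-grows-or-fixed zero    S = inj₁ z≤n
  ^-grows-or-fixed (suc i) S with ^-grows-or-fixed i S
  ... | inj₂ fixed = inj₂ (cong f fixed)
  ... | inj₁ grown with ⊆⇒≡⊎⊂ (inflationary ((f ^ i) S))
  ...   | inj₁ same  = inj₂ (cong f (≡-sym same))
  ...   | inj₂ grows = inj₁ (≤-<-trans grown (p⊂q⇒∣p∣<∣q∣ grows))

  ^-fixed : ∀ S → f ((f ^ suc N) S) ≡ (f ^ suc N) S
  ^-fixed S with ^-grows-or-fixed (suc N) S
  ... | inj₂ fixed = fixed
  ... | inj₁ grown = contradiction (∣p∣≤n ((f ^ suc N) S)) (<⇒≱ grown)

module FiniteReachability {N ℓ} {R : Rel (Fin N) ℓ} (R? : Decidable R) where
  open import Function.Endo.Propositional (Subset N) using (_^_)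

  successor? : ∀ S w → Dec (∃ λ v → v ∈ S × R v w)
  successor? S w = any? (λ v → v ∈? S ×-dec R? v w)

  successors : Subset N → Subset N
  successors S = tabulate (does ∘ successor? S)

  expand : Subset N → Subset N
  expand S = S ∪ successors S

  reachable : Fin N → Subset N
  reachable u = (expand ^ suc N) ⁅ u ⁆

  private
    expand-inflationary : ∀ S → S ⊆ expand S
    expand-inflationary S = p⊆p∪q (successors S)

    ∈-expand-iterate⁻ : ∀ i {u w} → w ∈ (expand ^ i) ⁅ u ⁆ → Star R u w
    ∈-expand-iterate⁻ zero    {u} w∈ rewrite x∈⁅y⁆⇒x≡y u w∈ = ε
    ∈-expand-iterate⁻ (suc i) w∈ with x∈p∪q⁻ _ _ w∈
    ... | inj₁ w∈S = ∈-expand-iterate⁻ i w∈S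
    ... | inj₂ w∈succ with ⇔.to (∈-tabulate-does (successor? _)) w∈succ
    ...   | v , v∈S , Rvw = ∈-expand-iterate⁻ i v∈S ◅◅ (Rvw ◅ ε)

  ∈-reachable⁻ : ∀ {u w} → w ∈ reachable u → Star R u w
  ∈-reachable⁻ = ∈-expand-iterate⁻ (suc N)

  reachable-closed : ∀ {u v w} → v ∈ reachable u → R v w → w ∈ reachable u
  reachable-closed {u} v∈ Rvw =
    subst (_ ∈_) (^-fixed expand expand-inflationary ⁅ u ⁆)
      (q⊆p∪q _ _ (⇔.from (∈-tabulate-does (successor? _)) (_ , v∈ , Rvw)))

  ∈-reachable⁺ : ∀ {u w} → Star R u w → w ∈ reachable u
  ∈-reachable⁺ {u} = go (⊆-^ expand expand-inflationary (suc N) (x∈⁅x⁆ u))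
    where
    go : ∀ {v w} → v ∈ reachable u → Star R v w → w ∈ reachable u
    go v∈ ε           = v∈
    go v∈ (Rvv′ ◅ path) = go (reachable-closed v∈ Rvv′) path

-- Splitting Fin N along a subset

record Partition {N : ℕ} (K : Subset N) : Set where
  field
    {k m}  : ℕ
    split  : Fin N ↔ (Fin k ⊎ Fin m)
    left∈  : ∀ i → from split (inj₁ i) ∈ K
    right∉ : ∀ j → from split (inj₂ j) ∉ K

  ι₁ : Fin k → Fin N
  ι₁ = from split ∘ inj₁

  ι₂ : Fin m → Fin N
  ι₂ = from split ∘ inj₂

  ι₁-injective : ∀ {i j} → ι₁ i ≡ ι₁ j → i ≡ j
  ι₁-injective {i} {j} ι₁i≡ι₁j = inj₁-injective (begin
    inj₁ i           ≡⟨ strictlyInverseˡ split (inj₁ i) ⟨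
    to split (ι₁ i)  ≡⟨ cong (to split) ι₁i≡ι₁j ⟩
    to split (ι₁ j)  ≡⟨ strictlyInverseˡ split (inj₁ j) ⟩
    inj₁ j           ∎)
    where open ≡-Reasoning

  ι₁-onto : ∀ {w} → w ∈ K → ∃ λ i → ι₁ i ≡ w
  ι₁-onto {w} w∈K with to split w | strictlyInverseʳ split w
  ... | inj₁ i | ι₁i≡w = i , ι₁i≡w
  ... | inj₂ j | ι₂j≡w = contradiction (subst (_∈ K) (≡-sym ι₂j≡w) w∈K) (right∉ j)

  image-ι₁⊆ : ∀ T → image ι₁ T ⊆ K
  image-ι₁⊆ T w∈ with ⇔.to (∈-image ι₁) w∈
  ... | i , _ , refl = left∈ i

∁-Partition : ∀ {N} {K : Subset N} → Partition K → Partition (∁ K)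
∁-Partition P = record
  { split  = ↔-trans split swap-↔
  ; left∈  = x∉p⇒x∈∁p ∘ right∉
  ; right∉ = x∈p⇒x∉∁p ∘ left∈
  }
  where open Partition P

sucˡ-↔ : ∀ {N k m} → Fin N ↔ (Fin k ⊎ Fin m) → Fin (suc N) ↔ (Fin (suc k) ⊎ Fin m)
sucˡ-↔ {N} {k} {m} f = mk↔ₛ′ to′ from′ to∘from from∘to
  where
  to′ : Fin (suc N) → Fin (suc k) ⊎ Fin m
  to′ zero    = inj₁ zero
  to′ (suc w) = map₁ suc (to f w)
  from′ : Fin (suc k) ⊎ Fin m → Fin (suc N)
  from′ (inj₁ zero)    = zero
  from′ (inj₁ (suc i)) = suc (from f (inj₁ i))
  from′ (inj₂ j)       = suc (from f (inj₂ j))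
  to∘from : ∀ y → to′ (from′ y) ≡ y
  to∘from (inj₁ zero)    = refl
  to∘from (inj₁ (suc i)) = cong (map₁ suc) (strictlyInverseˡ f (inj₁ i))
  to∘from (inj₂ j)       = cong (map₁ suc) (strictlyInverseˡ f (inj₂ j))
  from∘map₁-suc : ∀ y → from′ (map₁ suc y) ≡ suc (from f y)
  from∘map₁-suc (inj₁ _) = refl
  from∘map₁-suc (inj₂ _) = refl
  from∘to : ∀ w → from′ (to′ w) ≡ w
  from∘to zero    = refl
  from∘to (suc w) = trans (from∘map₁-suc (to f w)) (cong suc (strictlyInverseʳ f w))

sucʳ-↔ : ∀ {N k m} → Fin N ↔ (Fin k ⊎ Fin m) → Fin (suc N) ↔ (Fin k ⊎ Fin (suc m))
sucʳ-↔ f = ↔-trans (sucˡ-↔ (↔-trans f swap-↔)) swap-↔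

partition : ∀ {N} (K : Subset N) → Partition K
partition []            = record { split = +↔⊎ {0} {0} ; left∈ = λ () ; right∉ = λ () }
partition (inside ∷ K)  = record
  { split  = sucˡ-↔ split
  ; left∈  = λ { zero → here ; (suc i) → there (left∈ i) }
  ; right∉ = λ j → right∉ j ∘ drop-there
  }
  where open Partition (partition K)
partition (outside ∷ K) = record
  { split  = sucʳ-↔ split
  ; left∈  = there ∘ left∈
  ; right∉ = λ { zero () ; (suc j) → right∉ j ∘ drop-there }
  }
  where open Partition (partition K)

inducedSubgraph : (G : SimpleGraph) {k : ℕ} → (Fin k → Fin (n G)) → SimpleGraph
inducedSubgraph G {k} ι = record
  { n     = k
  ; adj   = λ i j → adj G (ι i) (ι j)
  ; sym   = λ i j → sym G (ι i) (ι j)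
  ; irref = λ i → irref G (ι i)
  }

-- The edge relation of the complement graph Ḡ.
NonAdjacent : (G : SimpleGraph) → Rel (Fin (n G)) _
NonAdjacent G u w = u ≢ w × adj G u w ≡ false

nonAdjacent? : (G : SimpleGraph) → Decidable (NonAdjacent G)
nonAdjacent? G u w = ¬? (u ≟ᶠ w) ×-dec (adj G u w ≟ false)

module _ (G : SimpleGraph) where

  nonempty : (S : V (IAR G)) → Nonempty (proj₁ S)
  nonempty (S , [ S-ok ]) = recompute (nonempty? S) (proj₁ S-ok)

  independent : (S : V (IAR G)) → Independent G (proj₁ S)
  independent (S , [ S-ok ]) u w u∈ w∈ = recompute (adj G u w ≟ false) (proj₂ S-ok u w u∈ w∈)

  ⊆-independent : ∀ {S T} → S ⊆ T → Independent G T → Independent G S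
  ⊆-independent S⊆T T-ind u w u∈ w∈ = T-ind u w (S⊆T u∈) (S⊆T w∈)

  ⁅⁆-independent : ∀ u → Independent G ⁅ u ⁆
  ⁅⁆-independent u a b a∈ b∈ rewrite x∈⁅y⁆⇒x≡y u a∈ | x∈⁅y⁆⇒x≡y u b∈ = irref G u

  module _ {k} (ι : Fin k → Fin (n G)) where

    preimage-independent : ∀ {S} → Independent G S → Independent (inducedSubgraph G ι) (preimage ι S)
    preimage-independent S-ind i j i∈ j∈ =
      S-ind (ι i) (ι j) (⇔.to (∈-preimage ι) i∈) (⇔.to (∈-preimage ι) j∈)

    image-independent : ∀ {T} → Independent (inducedSubgraph G ι) T → Independent G (image ι T)
    image-independent T-ind u w u∈ w∈ with ⇔.to (∈-image ι) u∈ | ⇔.to (∈-image ι) w∈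
    ... | i , i∈ , refl | j , j∈ , refl = T-ind i j i∈ j∈

  pair : ∀ {u w} → NonAdjacent G u w → V (IAR G)
  pair {u} {w} (_ , uw) = ⁅ u ⁆ ∪ ⁅ w ⁆ , [ ((u , p⊆p∪q ⁅ w ⁆ (x∈⁅x⁆ u)) , independent-pair) ]
    where
    independent-pair : Independent G (⁅ u ⁆ ∪ ⁅ w ⁆)
    independent-pair a b a∈ b∈ with x∈p∪q⁻ ⁅ u ⁆ ⁅ w ⁆ a∈ | x∈p∪q⁻ ⁅ u ⁆ ⁅ w ⁆ b∈
    ... | inj₁ a∈u | inj₁ b∈u = ⁅⁆-independent u a b a∈u b∈u
    ... | inj₂ a∈w | inj₂ b∈w = ⁅⁆-independent w a b a∈w b∈w
    ... | inj₁ a∈u | inj₂ b∈w rewrite x∈⁅y⁆⇒x≡y u a∈u | x∈⁅y⁆⇒x≡y w b∈w = uw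
    ... | inj₂ a∈w | inj₁ b∈u rewrite x∈⁅y⁆⇒x≡y w a∈w | x∈⁅y⁆⇒x≡y u b∈u = trans (sym G w u) uw

  Reachable-sym : ∀ {S T} → Reachable (IAR G) S T → Reachable (IAR G) T S
  Reachable-sym = reverse swap

  ⊆⇒Reachable : (S T : V (IAR G)) → proj₁ S ⊆ proj₁ T → Reachable (IAR G) S T
  ⊆⇒Reachable (S , S-ok) T S⊆T = lift (⊆⇒Star-AddsOne S⊆T) S-ok
    where
    lift : ∀ {U} → Star AddsOne U (proj₁ T) → (U-ok : Irrelevant (Nonempty U × Independent G U)) →
           Reachable (IAR G) (U , U-ok) T
    lift ε                      _        = ε
    lift (U→U′ ◅ U′⇝T) [ U-ok ] = inj₁ U→U′ ◅ lift U′⇝T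
      [ ( (proj₁ (proj₁ U-ok) , AddsOne⇒⊆ U→U′ (proj₂ (proj₁ U-ok)))
        , ⊆-independent (Star-AddsOne⇒⊆ U′⇝T) (independent T)) ]

  shared⇒Reachable : ∀ {u} (S T : V (IAR G)) → u ∈ proj₁ S → u ∈ proj₁ T → Reachable (IAR G) S T
  shared⇒Reachable {u} S T u∈S u∈T =
    Reachable-sym (⊆⇒Reachable ⁅u⁆ S (⁅⁆⊆ u∈S)) ◅◅ ⊆⇒Reachable ⁅u⁆ T (⁅⁆⊆ u∈T)
    where
    ⁅u⁆ : V (IAR G)
    ⁅u⁆ = ⁅ u ⁆ , [ ((u , x∈⁅x⁆ u) , ⁅⁆-independent u) ]

  Star⇒Reachable : ∀ {u w} (S T : V (IAR G)) → u ∈ proj₁ S → w ∈ proj₁ T →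
                   Star (NonAdjacent G) u w → Reachable (IAR G) S T
  Star⇒Reachable S T u∈S u∈T ε = shared⇒Reachable S T u∈S u∈T
  Star⇒Reachable {u} S T u∈S w∈T (_◅_ {j = v} uv v⇝w) =
    shared⇒Reachable S (pair uv) u∈S (p⊆p∪q ⁅ v ⁆ (x∈⁅x⁆ u))
      ◅◅ Star⇒Reachable (pair uv) T (q⊆p∪q ⁅ u ⁆ ⁅ v ⁆ (x∈⁅x⁆ v)) w∈T v⇝w

  independent⇒Star : ∀ {u w} (S : V (IAR G)) → u ∈ proj₁ S → w ∈ proj₁ S → Star (NonAdjacent G) u w
  independent⇒Star {u} {w} S u∈ w∈ with u ≟ᶠ w
  ... | yes refl = ε
  ... | no u≢w   = (u≢w , independent S u w u∈ w∈) ◅ ε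

  edge⇒shared : ∀ {S T} → E (IAR G) S T → ∃ λ u → u ∈ proj₁ S × u ∈ proj₁ T
  edge⇒shared {S}     (inj₁ S→T) = let u , u∈ = nonempty S in u , u∈ , AddsOne⇒⊆ S→T u∈
  edge⇒shared {T = T} (inj₂ T→S) = let u , u∈ = nonempty T in u , AddsOne⇒⊆ T→S u∈ , u∈

  Reachable⇒Star : ∀ {u w S T} → Reachable (IAR G) S T → u ∈ proj₁ S → w ∈ proj₁ T →
                   Star (NonAdjacent G) u w
  Reachable⇒Star {S = S} ε u∈ w∈ = independent⇒Star S u∈ w∈
  Reachable⇒Star {S = S} (_◅_ {j = S′} S→S′ S′⇝T) u∈ w∈ =
    let v , v∈S , v∈S′ = edge⇒shared {S} {S′} S→S′
    in independent⇒Star S u∈ v∈S ◅◅ Reachable⇒Star S′⇝T v∈S′ w∈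

IAR-restrict : (G : SimpleGraph) {K : Subset (n G)} (P : Partition K) →
               induced (IAR G) (λ S → proj₁ S ⊆ K) ≅ IAR (inducedSubgraph G (Partition.ι₁ P))
IAR-restrict G {K} P = mk≅ restrict extend
  (λ S → Σ-irrelevant-≡ (Σ-irrelevant-≡ (image-preimage ι₁ (in-range S))))
  (λ T → Σ-irrelevant-≡ (preimage-image ι₁ ι₁-injective (proj₁ T)))
  (λ {S} {T} → ⊎-map (AddsOne-preimage ι₁ ι₁-injective (in-range T))
                     (AddsOne-preimage ι₁ ι₁-injective (in-range S)))
  (⊎-map (AddsOne-image ι₁ ι₁-injective) (AddsOne-image ι₁ ι₁-injective))
  where
  open Partition P
  Inside : Graph
  Inside = induced (IAR G) (λ S → proj₁ S ⊆ K)

  in-range : (S : V Inside) → WithinRange ι₁ (proj₁ (proj₁ S))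
  in-range ((S , _) , [ S⊆K ]) w∈ = ι₁-onto (recompute (S ⊆? K) S⊆K w∈)

  restrict : V Inside → V (IAR (inducedSubgraph G ι₁))
  restrict ((S , [ S-ok ]) , [ S⊆K ]) = preimage ι₁ S ,
    [ (preimage-nonempty ι₁ (ι₁-onto ∘ S⊆K) (proj₁ S-ok) , preimage-independent G ι₁ (proj₂ S-ok)) ]

  extend : V (IAR (inducedSubgraph G ι₁)) → V Inside
  extend (T , [ T-ok ]) = (image ι₁ T ,
    [ (image-nonempty ι₁ (proj₁ T-ok) , image-independent G ι₁ (proj₂ T-ok)) ]) , [ image-ι₁⊆ T ]

join-decomposition : (G : SimpleGraph) {k m : ℕ} (f : Fin (n G) ↔ (Fin k ⊎ Fin m)) →
  (∀ i j → adj G (from f (inj₁ i)) (from f (inj₂ j)) ≡ true) →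
  toGraph G ≅ toGraph (inducedSubgraph G (from f ∘ inj₁) ⋈ inducedSubgraph G (from f ∘ inj₂))
join-decomposition G {k} {m} f cross = record
  { to      = to σ
  ; from    = from σ
  ; from-to = strictlyInverseʳ σ
  ; to-from = strictlyInverseˡ σ
  ; edges   = λ u v → mk⇔ (subst (_≡ true) (adj≡ u v)) (subst (_≡ true) (≡-sym (adj≡ u v)))
  }
  where
  σ : Fin (n G) ↔ Fin (k + m)
  σ = ↔-trans f (↔-sym +↔⊎)
  G₁⋈G₂ : SimpleGraph
  G₁⋈G₂ = inducedSubgraph G (from f ∘ inj₁) ⋈ inducedSubgraph G (from f ∘ inj₂)
  adj-from : ∀ a b → adj G (from f a) (from f b) ≡ adj G₁⋈G₂ (join k m a) (join k m b)
  adj-from a b with splitAt k (join k m a) | splitAt-join k m a | splitAt k (join k m b) | splitAt-join k m b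
  ... | inj₁ i | refl | inj₁ j | refl = refl
  ... | inj₂ i | refl | inj₂ j | refl = refl
  ... | inj₁ i | refl | inj₂ j | refl = cross i j
  ... | inj₂ i | refl | inj₁ j | refl = trans (sym G _ _) (cross j i)
  adj≡ : ∀ u v → adj G u v ≡ adj G₁⋈G₂ (to σ u) (to σ v)
  adj≡ u v = trans (≡-sym (cong₂ (adj G) (strictlyInverseʳ f u) (strictlyInverseʳ f v)))
                   (adj-from (to f u) (to f v))

module ComplementComponent (G : SimpleGraph) (x : V (IAR G)) where
  open FiniteReachability (nonAdjacent? G)

  v : Fin (n G)
  v = proj₁ (nonempty G x)

  v∈x : v ∈ proj₁ x
  v∈x = proj₂ (nonempty G x)

  K : Subset (n G)
  K = reachable v

  Reachable⇔⊆K : ∀ S → Reachable (IAR G) x S ⇔ proj₁ S ⊆ K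
  Reachable⇔⊆K S = mk⇔
    (λ x⇝S {_} w∈S → ∈-reachable⁺ (Reachable⇒Star G x⇝S v∈x w∈S))
    (λ S⊆K → let w , w∈S = nonempty G S in
      Star⇒Reachable G x S v∈x w∈S (∈-reachable⁻ (S⊆K w∈S)))

  ¬Reachable⇔⊆∁K : ∀ S → (¬ Reachable (IAR G) x S) ⇔ proj₁ S ⊆ ∁ K
  ¬Reachable⇔⊆∁K S = mk⇔
    (λ x⇸S {w} w∈S → x∉p⇒x∈∁p λ w∈K →
      x⇸S (Star⇒Reachable G x S v∈x w∈S (∈-reachable⁻ w∈K)))
    (λ S⊆∁K x⇝S → let w , w∈S = nonempty G S in
      x∈∁p⇒x∉p (S⊆∁K w∈S) (⇔.to (Reachable⇔⊆K S) x⇝S w∈S))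

  K-∁K-adjacent : ∀ {u w} → u ∈ K → w ∉ K → adj G u w ≡ true
  K-∁K-adjacent {u} {w} u∈K w∉K with adj G u w in uw
  ... | true  = refl
  ... | false = contradiction (reachable-closed u∈K (u≢w , uw)) w∉K
    where
    u≢w : u ≢ w
    u≢w refl = w∉K u∈K

lemma4p5 : (G : SimpleGraph) (x : V (IAR G)) →
    Σ SimpleGraph λ G₁ → Σ SimpleGraph λ G₂ →
      (toGraph G ≅ toGraph (G₁ ⋈ G₂))
      × (component (IAR G) x ≅ IAR G₁)
      × (minusComponent (IAR G) x ≅ IAR G₂)
lemma4p5 G x =
    inducedSubgraph G ι₁
  , inducedSubgraph G ι₂
  , join-decomposition G split (λ i j → K-∁K-adjacent (left∈ i) (right∉ j))
  , ≅-trans (induced-cong Reachable⇔⊆K) (IAR-restrict G P)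
  -- the left embedding of ∁-Partition P is ι₂ by definition
  , ≅-trans (induced-cong ¬Reachable⇔⊆∁K) (IAR-restrict G (∁-Partition P))
  where
  open ComplementComponent G x
  P : Partition K
  P = partition K
  open Partition P
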